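{- Let $S=(1,s_2,\ldots)$ and $S'=(s_1',s_2',\ldots)$ be packing sequences such that $s_i'=\lfloor s_{i+1}/2\rfloor$ for every positive integer $i$, and let $n\ge 3$ be an integer. Then: (i) $\chi_S(C_{2n})\le \chi_{S'}(C_n)+1$; (ii) if the cycle $C_{2n}$ is $\chi_S$-critical, then $C_n$ is $\chi_{S'}$-critical.
   Context: A packing sequence is a non-decreasing infinite sequence $S=(s_1,s_2,\ldots)$ of positive integers. For a graph $G$, a map $\phi\colon V(G)\to\{1,\ldots,k\}$ is an $S$-packing $k$-coloring if any two distinct vertices $u,v$ with $\phi(u)=\phi(v)=i$ satisfy $d_G(u,v) > s_i$; $\chi_S(G)$ is the least such $k$. A graph $G$ is $\chi_S$-critical if $\chi_S(H)<\chi_S(G)$ for every proper subgraph $H$ of $G$. $C_m$ is the cycle on $m$ vertices. -}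

module Defs where

open import Data.Nat using (ℕ; zero; suc; _≤_; _<_)
open import Data.Fin using (Fin; toℕ)
open import Data.Product using (Σ; _×_; _,_)
open import Data.Sum using (_⊎_; inj₁; inj₂)
open import Data.Unit using (⊤)
open import Relation.Nullary using (¬_)
open import Relation.Binary.PropositionalEquality using (_≡_)

-- Packing sequences, stored 0-indexed: S i is s_{i+1}.
IsPackingSeq : (ℕ → ℕ) → Set
IsPackingSeq S = (∀ i → 1 ≤ S i) × (∀ i → S i ≤ S (suc i))

-- Using a common
-- ambient vertex type Fin n lets subgraphs be expressed as sub-predicates.
record Graph (n : ℕ) : Set₁ where
  field
    vert     : Fin n → Set
    edge     : Fin n → Fin n → Set
    edge-sym : ∀ {u v} → edge u v → edge v u
    edge-vert : ∀ {u v} → edge u v → vert u × vert v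
open Graph public

data Walk {n : ℕ} (G : Graph n) : Fin n → Fin n → ℕ → Set where
  nil  : ∀ {u} → Walk G u u 0
  cons : ∀ {u w v ℓ} → edge G u w → Walk G w v ℓ → Walk G u v (suc ℓ)

-- d_G(u,v) > s : there is no u–v walk of length at most s
-- (covers disconnected pairs, whose distance is infinite).
DistGt : ∀ {n} → Graph n → Fin n → Fin n → ℕ → Set
DistGt G u v s = ∀ ℓ → ℓ ≤ s → ¬ Walk G u v ℓ

-- An S-packing k-coloring (colour j : Fin k stands for colour j+1, whose
-- packing bound is s_{j+1} = S (toℕ j)).
IsPackingColoring : ∀ {n} → (ℕ → ℕ) → (G : Graph n) → (k : ℕ) → (Fin n → Fin k) → Set
IsPackingColoring S G k φ =
  ∀ u v → vert G u → vert G v → ¬ (u ≡ v) → φ u ≡ φ v → DistGt G u v (S (toℕ (φ u)))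

HasPackingColoring : ∀ {n} → (ℕ → ℕ) → Graph n → ℕ → Set
HasPackingColoring S G k = Σ (Fin _ → Fin k) (IsPackingColoring S G k)

IsChiS : ∀ {n} → (ℕ → ℕ) → Graph n → ℕ → Set
IsChiS S G k = HasPackingColoring S G k × (∀ j → HasPackingColoring S G j → k ≤ j)

Subgraph : ∀ {n} → Graph n → Graph n → Set
Subgraph H G = (∀ v → vert H v → vert G v) × (∀ u v → edge H u v → edge G u v)

ProperSubgraph : ∀ {n} → Graph n → Graph n → Set
ProperSubgraph H G =
  Subgraph H G ×
  ((Σ (Fin _) λ v → vert G v × ¬ vert H v) ⊎
   (Σ (Fin _) λ u → Σ (Fin _) λ v → edge G u v × ¬ edge H u v))

IsCritical : ∀ {n} → (ℕ → ℕ) → Graph n → Set₁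
IsCritical {n} S G = ∀ (H : Graph n) → ProperSubgraph H G →
  ∀ kH kG → IsChiS S H kH → IsChiS S G kG → kH < kG

CycleEdge : (m : ℕ) → Fin m → Fin m → Set
CycleEdge m u v =
  (suc (toℕ u) ≡ toℕ v) ⊎ (suc (toℕ v) ≡ toℕ u) ⊎
  ((toℕ u ≡ 0) × (suc (toℕ v) ≡ m)) ⊎ ((toℕ v ≡ 0) × (suc (toℕ u) ≡ m))

private
  cyc-sym : ∀ {m u v} → CycleEdge m u v → CycleEdge m v u
  cyc-sym (inj₁ p) = inj₂ (inj₁ p)
  cyc-sym (inj₂ (inj₁ p)) = inj₁ p
  cyc-sym (inj₂ (inj₂ (inj₁ p))) = inj₂ (inj₂ (inj₂ p))
  cyc-sym (inj₂ (inj₂ (inj₂ p))) = inj₂ (inj₂ (inj₁ p))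

Cycle : (m : ℕ) → Graph m
Cycle m = record
  { vert = λ _ → ⊤
  ; edge = CycleEdge m
  ; edge-sym = cyc-sym
  ; edge-vert = λ _ → _ , _
  }

{-# OPTIONS --safe #-}
-- (i) Given an S′-packing colouring φ of C_n, give the even vertices of C_2n colour 1 and the odd
-- vertex 2i+1 colour 1 + φ(i).  A walk of length ℓ between odd vertices of C_2n projects to a walk
-- of length at most ℓ/2 in C_n, and s′_i = ⌊s_{i+1}/2⌋.
-- (ii) A proper subgraph H of C_n embeds in the path P_n.  P_2n is a proper subgraph of the critical
-- C_2n, so χ_S(P_2n) < χ_S(C_2n) ≤ χ_S′(C_n) + 1.  In an S-packing colouring of P_2n no two
-- neighbours have colour 1, so one can pick n vertices of other colours with consecutive gaps 1 or 2;
-- restricting to them and lowering every colour by one gives an S′-packing colouring of P_n, whence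
-- χ_S′(H) ≤ χ_S(P_2n) - 1 < χ_S′(C_n).  The values χ exist only classically, but the conclusion is a
-- decidable inequality, so their double-negated existence suffices.
module Submission where

open import Defs
open import Data.Empty using (⊥-elim)
open import Data.Fin using (Fin; toℕ; fromℕ; fromℕ<; punchOut) renaming (zero to fzero; suc to fsuc)
open import Data.Fin.Properties using (toℕ-injective; toℕ-fromℕ<; toℕ-fromℕ; toℕ<n; punchIn-punchOut)
  renaming (suc-injective to fsuc-injective; _≟_ to _≟ᶠ_)
open import Data.Nat
  using (ℕ; zero; suc; _+_; _*_; _∸_; _≤_; _<_; _/_; _%_; z≤n; s≤s; s≤s⁻¹; _≤?_; _<?_; NonZero)
open import Data.Nat.DivMod
open import Data.Nat.Properties
open import Data.Product using (Σ; _×_; _,_; proj₁; proj₂)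
open import Data.Sum using (_⊎_; inj₁; inj₂; [_,_]; swap)
open import Data.Unit using (⊤; tt)
open import Function using (_∘_; id)
open import Relation.Binary using (tri<; tri≈; tri>)
open import Relation.Nullary using (¬_; yes; no; contradiction)
open import Relation.Nullary.Decidable using (decidable-stable; map′)
open import Relation.Unary using (Decidable)
open import Relation.Binary.PropositionalEquality hiding ([_])

¬¬-least : {P : ℕ → Set} (n : ℕ) → P n → ¬ ¬ (Σ ℕ λ k → P k × (∀ j → P j → k ≤ j))
¬¬-least {P} n Pn noLeast = absentBelow (suc n) n ≤-refl Pn
  where
  absentBelow : ∀ b j → j < b → ¬ P j
  absentBelow (suc b) j (s≤s j≤b) Pj = noLeast (j , Pj , least)
    where
    least : ∀ i → P i → j ≤ i
    least i Pi with j ≤? i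
    ... | yes j≤i = j≤i
    ... | no j≰i = contradiction Pi (absentBelow b i (≤-trans (≰⇒> j≰i) j≤b))

¬¬-IsChiS : ∀ {n} (S : ℕ → ℕ) (G : Graph n) → ¬ ¬ Σ ℕ (IsChiS S G)
¬¬-IsChiS {n} S G = ¬¬-least n (id , λ _ _ _ _ u≢v u≡v → contradiction u≡v u≢v)

walk≤1 : ∀ {n} {G : Graph n} {u v ℓ} → ℓ ≤ 1 → Walk G u v ℓ → u ≡ v ⊎ edge G u v
walk≤1 _ nil = inj₁ refl
walk≤1 _ (cons e nil) = inj₂ e
walk≤1 (s≤s ()) (cons _ (cons _ _))

module _ {n : ℕ} {G : Graph n} where

  walk-snoc : ∀ {u v w ℓ} → Walk G u v ℓ → edge G v w → Walk G u w (suc ℓ)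
  walk-snoc nil e = cons e nil
  walk-snoc (cons e′ W) e = cons e′ (walk-snoc W e)

  walk-reverse : ∀ {u v ℓ} → Walk G u v ℓ → Walk G v u ℓ
  walk-reverse nil = nil
  walk-reverse (cons e W) = walk-snoc (walk-reverse W) (edge-sym G e)

record InjectiveHom {n m : ℕ} (H : Graph n) (G : Graph m) : Set where
  field
    map       : Fin n → Fin m
    injective : ∀ {u v} → map u ≡ map v → u ≡ v
    map-vert  : ∀ {v} → vert H v → vert G (map v)
    map-edge  : ∀ {u v} → edge H u v → edge G (map u) (map v)

  map-walk : ∀ {u v ℓ} → Walk H u v ℓ → Walk G (map u) (map v) ℓ
  map-walk nil = nil
  map-walk (cons e W) = cons (map-edge e) (map-walk W)

coloring-pullback : ∀ {n m k} {S : ℕ → ℕ} {H : Graph n} {G : Graph m} →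
  InjectiveHom H G → HasPackingColoring S G k → HasPackingColoring S H k
coloring-pullback f (φ , φ-packing) = φ ∘ map , λ u v u∈H v∈H u≢v same ℓ ℓ≤s W →
  φ-packing (map u) (map v) (map-vert u∈H) (map-vert v∈H) (u≢v ∘ injective) same ℓ ℓ≤s (map-walk W)
  where open InjectiveHom f

packing-fromOrdered : ∀ {n k} {S : ℕ → ℕ} {G : Graph n} (φ : Fin n → Fin k) →
  (∀ u v → toℕ u < toℕ v → φ u ≡ φ v → DistGt G u v (S (toℕ (φ u)))) →
  IsPackingColoring S G k φ
packing-fromOrdered {S = S} φ far u v _ _ u≢v same with <-cmp (toℕ u) (toℕ v)
... | tri< u<v _ _ = far u v u<v same
... | tri≈ _ u≡v _ = contradiction (toℕ-injective u≡v) u≢v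
... | tri> _ _ v<u = λ ℓ ℓ≤s W →
  far v u v<u (sym same) ℓ (subst (λ c → ℓ ≤ S (toℕ c)) same ℓ≤s) (walk-reverse W)

m*n≤o⇒n≤o/m : ∀ m {n o} .{{_ : NonZero m}} → m * n ≤ o → n ≤ o / m
m*n≤o⇒n≤o/m m {n} {o} mn≤o = begin
  n             ≡⟨ m*n/n≡m n m ⟨
  n * m / m     ≤⟨ /-monoˡ-≤ m (≤-trans (≤-reflexive (*-comm n m)) mn≤o) ⟩
  o / m         ∎
  where open ≤-Reasoning

n≤o/m⇒m*n≤o : ∀ m {n o} .{{_ : NonZero m}} → n ≤ o / m → m * n ≤ o
n≤o/m⇒m*n≤o m {n} {o} n≤o/m = begin
  m * n         ≡⟨ *-comm m n ⟩
  n * m         ≤⟨ *-monoˡ-≤ m n≤o/m ⟩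
  o / m * m     ≤⟨ m/n*n≤m o m ⟩
  o             ∎
  where open ≤-Reasoning

Next : (m : ℕ) → Fin m → Fin m → Set
Next m u v = suc (toℕ u) ≡ toℕ v ⊎ (toℕ v ≡ 0 × suc (toℕ u) ≡ m)

cycleEdge⇒next : ∀ {m u v} → CycleEdge m u v → Next m u v ⊎ Next m v u
cycleEdge⇒next (inj₁ p) = inj₁ (inj₁ p)
cycleEdge⇒next (inj₂ (inj₁ p)) = inj₂ (inj₁ p)
cycleEdge⇒next (inj₂ (inj₂ (inj₁ p))) = inj₂ (inj₂ p)
cycleEdge⇒next (inj₂ (inj₂ (inj₂ p))) = inj₁ (inj₂ p)

next⇒cycleEdge : ∀ {m u v} → Next m u v → CycleEdge m u v
next⇒cycleEdge (inj₁ p) = inj₁ p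
next⇒cycleEdge (inj₂ p) = inj₂ (inj₂ (inj₂ p))

next-injectiveˡ : ∀ {m u v w} → Next m u w → Next m v w → u ≡ v
next-injectiveˡ (inj₁ p) (inj₁ q) = toℕ-injective (suc-injective (trans p (sym q)))
next-injectiveˡ (inj₁ p) (inj₂ (w≡0 , _)) with trans p w≡0
... | ()
next-injectiveˡ (inj₂ (w≡0 , _)) (inj₁ q) with trans q w≡0
... | ()
next-injectiveˡ (inj₂ (_ , p)) (inj₂ (_ , q)) = toℕ-injective (suc-injective (trans p (sym q)))

stay-or-step : ∀ {n} {i i′ j : Fin n} → i ≡ j ⊎ Next n i j → i′ ≡ j ⊎ Next n i′ j →
  i ≡ i′ ⊎ CycleEdge n i i′
stay-or-step (inj₁ refl) (inj₁ refl) = inj₁ refl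
stay-or-step {n} (inj₁ refl) (inj₂ i′→i) = inj₂ (edge-sym (Cycle n) (next⇒cycleEdge i′→i))
stay-or-step (inj₂ i→i′) (inj₁ refl) = inj₂ (next⇒cycleEdge i→i′)
stay-or-step (inj₂ i→j) (inj₂ i′→j) = inj₁ (next-injectiveˡ i→j i′→j)

data Parity (x : ℕ) : Set where
  even : ∀ h → x ≡ 2 * h → Parity x
  odd  : ∀ h → x ≡ suc (2 * h) → Parity x

parity : ∀ x → Parity x
parity zero = even 0 refl
parity (suc x) with parity x
... | even h x≡2h = odd h (cong suc x≡2h)
... | odd h x≡1+2h = even (suc h) (trans (cong suc x≡1+2h) (sym (*-suc 2 h)))

2*-injective : ∀ {a b} → 2 * a ≡ 2 * b → a ≡ b
2*-injective {a} {b} = *-cancelˡ-≡ a b 2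

succ-of-even-is-odd : ∀ {x y} a b → suc x ≡ y → x ≡ 2 * a → y ≢ 2 * b
succ-of-even-is-odd a b x+1≡y x≡2a y≡2b =
  even≢odd b a (trans (sym y≡2b) (trans (sym x+1≡y) (cong suc x≡2a)))

succ-of-odd-is-even : ∀ {x y} a b → suc x ≡ y → x ≡ suc (2 * a) → y ≢ suc (2 * b)
succ-of-odd-is-even a b x+1≡y x≡1+2a y≡1+2b =
  even≢odd (suc a) b (trans (*-suc 2 a) (trans (cong suc (sym x≡1+2a)) (trans x+1≡y y≡1+2b)))

module _ {n : ℕ} where

  data Half (v : Fin (2 * n)) : Set where
    even : (i : Fin n) → toℕ v ≡ 2 * toℕ i → Half v
    odd  : (i : Fin n) → toℕ v ≡ suc (2 * toℕ i) → Half v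

  half<n : ∀ h {v : Fin (2 * n)} → 2 * h ≤ toℕ v → h < n
  half<n h {v} 2h≤v = *-cancelˡ-< 2 h n (≤-<-trans 2h≤v (toℕ<n v))

  half : (v : Fin (2 * n)) → Half v
  half v with parity (toℕ v)
  ... | even h v≡2h = even (fromℕ< h<n) (trans v≡2h (cong (2 *_) (sym (toℕ-fromℕ< h<n))))
    where h<n = half<n h (≤-reflexive (sym v≡2h))
  ... | odd h v≡1+2h = odd (fromℕ< h<n) (trans v≡1+2h (cong (suc ∘ (2 *_)) (sym (toℕ-fromℕ< h<n))))
    where h<n = half<n h (≤-trans (n≤1+n _) (≤-reflexive (sym v≡1+2h)))

  module _ {u v : Fin (2 * n)} where

    even-even-¬edge : ∀ a b → toℕ u ≡ 2 * a → toℕ v ≡ 2 * b → ¬ CycleEdge (2 * n) u v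
    even-even-¬edge a b u≡2a v≡2b (inj₁ p) = succ-of-even-is-odd a b p u≡2a v≡2b
    even-even-¬edge a b u≡2a v≡2b (inj₂ (inj₁ p)) = succ-of-even-is-odd b a p v≡2b u≡2a
    even-even-¬edge a b u≡2a v≡2b (inj₂ (inj₂ (inj₁ (_ , p)))) = succ-of-even-is-odd b n p v≡2b refl
    even-even-¬edge a b u≡2a v≡2b (inj₂ (inj₂ (inj₂ (_ , p)))) = succ-of-even-is-odd a n p u≡2a refl

    odd-odd-¬edge : ∀ a b → toℕ u ≡ suc (2 * a) → toℕ v ≡ suc (2 * b) → ¬ CycleEdge (2 * n) u v
    odd-odd-¬edge a b u≡1+2a v≡1+2b (inj₁ p) = succ-of-odd-is-even a b p u≡1+2a v≡1+2b
    odd-odd-¬edge a b u≡1+2a v≡1+2b (inj₂ (inj₁ p)) = succ-of-odd-is-even b a p v≡1+2b u≡1+2a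
    odd-odd-¬edge a b u≡1+2a v≡1+2b (inj₂ (inj₂ (inj₁ (u≡0 , _)))) with trans (sym u≡0) u≡1+2a
    ... | ()
    odd-odd-¬edge a b u≡1+2a v≡1+2b (inj₂ (inj₂ (inj₂ (v≡0 , _)))) with trans (sym v≡0) v≡1+2b
    ... | ()

    odd-even-edge : ∀ i j → toℕ u ≡ suc (2 * toℕ i) → toℕ v ≡ 2 * toℕ j →
      CycleEdge (2 * n) u v → i ≡ j ⊎ Next n i j
    odd-even-edge i j u≡1+2i v≡2j (inj₁ p) =
      inj₂ (inj₁ (2*-injective (trans (*-suc 2 (toℕ i)) (trans (cong suc (sym u≡1+2i)) (trans p v≡2j)))))
    odd-even-edge i j u≡1+2i v≡2j (inj₂ (inj₁ p)) =
      inj₁ (toℕ-injective (sym (2*-injective (suc-injective (trans (cong suc (sym v≡2j)) (trans p u≡1+2i))))))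
    odd-even-edge i j u≡1+2i v≡2j (inj₂ (inj₂ (inj₁ (u≡0 , _)))) with trans (sym u≡0) u≡1+2i
    ... | ()
    odd-even-edge i j u≡1+2i v≡2j (inj₂ (inj₂ (inj₂ (v≡0 , p)))) =
      inj₂ (inj₂ ( 2*-injective (trans (sym v≡2j) v≡0)
                 , 2*-injective (trans (*-suc 2 (toℕ i)) (trans (cong suc (sym u≡1+2i)) p))))

  -- A walk between odd vertices of C_2n alternates parity, and each odd-even-odd pair of steps
  -- projects to a step or a stay in C_n.
  walk-halve : ∀ {ℓ u v} (i i′ : Fin n) → Walk (Cycle (2 * n)) u v ℓ →
    toℕ u ≡ suc (2 * toℕ i) → toℕ v ≡ suc (2 * toℕ i′) →
    Σ ℕ λ d → 2 * d ≤ ℓ × Walk (Cycle n) i i′ d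
  walk-halve i i′ nil u≡1+2i u≡1+2i′ = 0 , z≤n , subst (λ i′ → Walk (Cycle n) i i′ 0) i≡i′ nil
    where i≡i′ = toℕ-injective (2*-injective (suc-injective (trans (sym u≡1+2i) u≡1+2i′)))
  walk-halve i i′ (cons e nil) u≡1+2i v≡1+2i′ =
    ⊥-elim (odd-odd-¬edge (toℕ i) (toℕ i′) u≡1+2i v≡1+2i′ e)
  walk-halve i i′ (cons {w = z} e (cons {w = x} e′ W)) u≡1+2i v≡1+2i′ with half z | half x
  ... | odd j z≡1+2j | _ = ⊥-elim (odd-odd-¬edge (toℕ i) (toℕ j) u≡1+2i z≡1+2j e)
  ... | even j z≡2j | even k x≡2k = ⊥-elim (even-even-¬edge (toℕ j) (toℕ k) z≡2j x≡2k e′)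
  ... | even j z≡2j | odd k x≡1+2k
    with walk-halve k i′ W x≡1+2k v≡1+2i′
       | stay-or-step (odd-even-edge i j u≡1+2i z≡2j e)
                      (odd-even-edge k j x≡1+2k z≡2j (edge-sym (Cycle (2 * n)) e′))
  ...  | d , 2d≤ℓ , W′ | inj₁ refl = d , ≤-trans 2d≤ℓ (m≤n+m _ 2) , W′
  ...  | d , 2d≤ℓ , W′ | inj₂ step =
    suc d , ≤-trans (≤-reflexive (*-suc 2 d)) (s≤s (s≤s 2d≤ℓ)) , cons step W′

  doubleColoring : ∀ {k} → (Fin n → Fin k) → Fin (2 * n) → Fin (suc k)
  doubleColoring φ v with half v
  ... | even _ _ = fzero
  ... | odd i _ = fsuc (φ i)

  doubleColoring-packing : ∀ {k} {S S′ : ℕ → ℕ} → S 0 ≤ 1 → (∀ i → S (suc i) / 2 ≤ S′ i) →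
    {φ : Fin n → Fin k} → IsPackingColoring S′ (Cycle n) k φ →
    IsPackingColoring S (Cycle (2 * n)) (suc k) (doubleColoring φ)
  doubleColoring-packing {S = S} {S′} S₀≤1 halfS≤S′ {φ} φ-packing u v _ _ u≢v with half u | half v
  ... | even i u≡2i | even j v≡2j = λ _ ℓ ℓ≤S₀ W →
    [ u≢v , even-even-¬edge (toℕ i) (toℕ j) u≡2i v≡2j ] (walk≤1 (≤-trans ℓ≤S₀ S₀≤1) W)
  ... | even _ _ | odd _ _ = λ ()
  ... | odd _ _ | even _ _ = λ ()
  ... | odd i u≡1+2i | odd j v≡1+2j = λ same ℓ ℓ≤S W →
    let (d , 2d≤ℓ , W′) = walk-halve i j W u≡1+2i v≡1+2j
    in φ-packing i j tt tt i≢j (fsuc-injective same) d (d≤S′ (≤-trans 2d≤ℓ ℓ≤S)) W′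
    where
    i≢j : i ≢ j
    i≢j refl = u≢v (toℕ-injective (trans u≡1+2i (sym v≡1+2j)))
    d≤S′ : ∀ {d} → 2 * d ≤ S (suc (toℕ (φ i))) → d ≤ S′ (toℕ (φ i))
    d≤S′ 2d≤S = ≤-trans (m*n≤o⇒n≤o/m 2 2d≤S) (halfS≤S′ _)

cycleColoring-doubling : ∀ {n k} {S S′ : ℕ → ℕ} → S 0 ≤ 1 → (∀ i → S (suc i) / 2 ≤ S′ i) →
  HasPackingColoring S′ (Cycle n) k → HasPackingColoring S (Cycle (2 * n)) (suc k)
cycleColoring-doubling {S = S} {S′} S₀≤1 halfS≤S′ (φ , φ-packing) =
  doubleColoring φ , doubleColoring-packing {S = S} {S′} S₀≤1 halfS≤S′ φ-packing

Path : (m : ℕ) → Graph m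
Path m = record
  { vert      = λ _ → ⊤
  ; edge      = λ u v → suc (toℕ u) ≡ toℕ v ⊎ suc (toℕ v) ≡ toℕ u
  ; edge-sym  = swap
  ; edge-vert = λ _ → tt , tt
  }

path-proper : ∀ {m} → 3 ≤ m → ProperSubgraph (Path m) (Cycle m)
path-proper {suc (suc (suc k))} (s≤s (s≤s (s≤s _))) =
  ((λ _ _ → tt) , λ _ _ → [ inj₁ , inj₂ ∘ inj₁ ]) ,
  inj₂ (fromℕ (2 + k) , fzero , closing , λ { (inj₁ ()) ; (inj₂ ()) })
  where
  closing : CycleEdge (3 + k) (fromℕ (2 + k)) fzero
  closing = inj₂ (inj₂ (inj₂ (refl , cong suc (toℕ-fromℕ (2 + k)))))

path-walk-≤ : ∀ {m u v ℓ} → Walk (Path m) u v ℓ → toℕ v ≤ toℕ u + ℓ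
path-walk-≤ {u = u} nil = m≤m+n (toℕ u) 0
path-walk-≤ {u = u} {ℓ = suc ℓ} (cons (inj₁ u+1≡w) W) =
  ≤-trans (path-walk-≤ W) (≤-reflexive (trans (cong (_+ ℓ) (sym u+1≡w)) (sym (+-suc (toℕ u) ℓ))))
path-walk-≤ {ℓ = suc ℓ} (cons (inj₂ w+1≡u) W) =
  ≤-trans (path-walk-≤ W) (+-mono-≤ (≤-trans (n≤1+n _) (≤-reflexive w+1≡u)) (n≤1+n ℓ))

path-walk : ∀ {m} d {u v : Fin m} → d + toℕ u ≡ toℕ v → Walk (Path m) u v d
path-walk zero {u} eq = subst (λ v → Walk (Path _) u v 0) (toℕ-injective eq) nil
path-walk {m} (suc d) {u} {v} eq =
  cons (inj₁ (sym (toℕ-fromℕ< u+1<m)))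
       (path-walk d (trans (cong (d +_) (toℕ-fromℕ< u+1<m)) (trans (+-suc d (toℕ u)) eq)))
  where
  u+1<m : suc (toℕ u) < m
  u+1<m = ≤-<-trans (≤-trans (s≤s (m≤n+m (toℕ u) d)) (≤-reflexive eq)) (toℕ<n v)

[m%d+n]%d≡[m+n]%d : ∀ m n d .{{_ : NonZero d}} → (m % d + n) % d ≡ (m + n) % d
[m%d+n]%d≡[m+n]%d m n d = begin
  (m % d + n) % d         ≡⟨ %-distribˡ-+ (m % d) n d ⟩
  (m % d % d + n % d) % d ≡⟨ cong (λ x → (x + n % d) % d) (m%n%n≡m%n m d) ⟩
  (m % d + n % d) % d     ≡⟨ %-distribˡ-+ m n d ⟨
  (m + n) % d             ∎
  where open ≡-Reasoning

[m+n%d]%d≡[m+n]%d : ∀ m n d .{{_ : NonZero d}} → (m + n % d) % d ≡ (m + n) % d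
[m+n%d]%d≡[m+n]%d m n d = begin
  (m + n % d) % d ≡⟨ cong (_% d) (+-comm m (n % d)) ⟩
  (n % d + m) % d ≡⟨ [m%d+n]%d≡[m+n]%d n m d ⟩
  (n + m) % d     ≡⟨ cong (_% d) (+-comm n m) ⟩
  (m + n) % d     ∎
  where open ≡-Reasoning

next⇒≡suc% : ∀ {m} .{{_ : NonZero m}} {u v : Fin m} → Next m u v → toℕ v ≡ suc (toℕ u) % m
next⇒≡suc% {m} {v = v} (inj₁ u+1≡v) = sym (trans (cong (_% m) u+1≡v) (m<n⇒m%n≡m (toℕ<n v)))
next⇒≡suc% {m} (inj₂ (v≡0 , u+1≡m)) = trans v≡0 (sym (trans (cong (_% m) u+1≡m) (n%n≡0 m)))

-- Rotating b to 0 turns every edge of C_m other than the one entering b into an edge of Path m.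
module Rotation {m : ℕ} .{{_ : NonZero m}} (b : Fin m) where

  rotate : Fin m → Fin m
  rotate v = (toℕ v + (m ∸ toℕ b)) mod m

  toℕ-rotate : ∀ v → toℕ (rotate v) ≡ (toℕ v + (m ∸ toℕ b)) % m
  toℕ-rotate v = toℕ-fromℕ< _

  unrotate : Fin m → Fin m
  unrotate w = (toℕ w + toℕ b) mod m

  unrotate-rotate : ∀ v → unrotate (rotate v) ≡ v
  unrotate-rotate v = toℕ-injective (begin
    toℕ (unrotate (rotate v))                  ≡⟨ toℕ-fromℕ< _ ⟩
    (toℕ (rotate v) + toℕ b) % m               ≡⟨ cong (λ x → (x + toℕ b) % m) (toℕ-rotate v) ⟩
    ((toℕ v + (m ∸ toℕ b)) % m + toℕ b) % m    ≡⟨ [m%d+n]%d≡[m+n]%d _ (toℕ b) m ⟩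
    (toℕ v + (m ∸ toℕ b) + toℕ b) % m          ≡⟨ cong (_% m) (+-assoc (toℕ v) _ _) ⟩
    (toℕ v + (m ∸ toℕ b + toℕ b)) % m          ≡⟨ cong (λ x → (toℕ v + x) % m) (m∸n+n≡m b≤m) ⟩
    (toℕ v + m) % m                            ≡⟨ [m+n]%n≡m%n (toℕ v) m ⟩
    toℕ v % m                                  ≡⟨ m<n⇒m%n≡m (toℕ<n v) ⟩
    toℕ v                                      ∎)
    where
    open ≡-Reasoning
    b≤m = <⇒≤ (toℕ<n b)

  rotate-injective : ∀ {u v} → rotate u ≡ rotate v → u ≡ v
  rotate-injective {u} {v} eq = trans (sym (unrotate-rotate u)) (trans (cong unrotate eq) (unrotate-rotate v))

  toℕ-rotate-b : toℕ (rotate b) ≡ 0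
  toℕ-rotate-b = trans (toℕ-rotate b) (trans (cong (_% m) (m+[n∸m]≡n (<⇒≤ (toℕ<n b)))) (n%n≡0 m))

  rotate-next : ∀ {u v} → Next m u v → toℕ (rotate v) ≡ suc (toℕ (rotate u)) % m
  rotate-next {u} {v} u→v = begin
    toℕ (rotate v)                       ≡⟨ toℕ-rotate v ⟩
    (toℕ v + c) % m                      ≡⟨ cong (λ x → (x + c) % m) (next⇒≡suc% u→v) ⟩
    (suc (toℕ u) % m + c) % m            ≡⟨ [m%d+n]%d≡[m+n]%d (suc (toℕ u)) c m ⟩
    suc (toℕ u + c) % m                  ≡⟨ [m+n%d]%d≡[m+n]%d 1 (toℕ u + c) m ⟨
    suc ((toℕ u + c) % m) % m            ≡⟨ cong (λ x → suc x % m) (toℕ-rotate u) ⟨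
    suc (toℕ (rotate u)) % m             ∎
    where
    open ≡-Reasoning
    c = m ∸ toℕ b

  rotate-step : ∀ {u v} → Next m u v → v ≢ b → suc (toℕ (rotate u)) ≡ toℕ (rotate v)
  rotate-step {u} {v} u→v v≢b with suc (toℕ (rotate u)) <? m
  ... | yes r+1<m = sym (trans (rotate-next u→v) (m<n⇒m%n≡m r+1<m))
  ... | no r+1≮m = contradiction (rotate-injective (toℕ-injective rotate-v≡rotate-b)) v≢b
    where
    rotate-v≡rotate-b : toℕ (rotate v) ≡ toℕ (rotate b)
    rotate-v≡rotate-b = begin
      toℕ (rotate v)           ≡⟨ rotate-next u→v ⟩
      suc (toℕ (rotate u)) % m ≡⟨ cong (_% m) (≤-antisym (toℕ<n (rotate u)) (≮⇒≥ r+1≮m)) ⟩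
      m % m                    ≡⟨ n%n≡0 m ⟩
      0                        ≡⟨ toℕ-rotate-b ⟨
      toℕ (rotate b)           ∎
      where open ≡-Reasoning

  path-embedding : ∀ {H : Graph m} → (∀ u v → edge H u v → CycleEdge m u v) →
    (∀ {u v} → edge H u v → Next m u v → v ≢ b) → InjectiveHom H (Path m)
  path-embedding {H} H⊆C no-entry = record
    { map       = rotate
    ; injective = rotate-injective
    ; map-vert  = λ _ → tt
    ; map-edge  = λ {u} {v} e → [ (λ u→v → inj₁ (rotate-step u→v (no-entry e u→v)))
                                , (λ v→u → inj₂ (rotate-step v→u (no-entry (edge-sym H e) v→u))) ]
                                (cycleEdge⇒next (H⊆C u v e))
    }

proper⇒pathEmbedding : ∀ {m} .{{_ : NonZero m}} {H : Graph m} →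
  ProperSubgraph H (Cycle m) → InjectiveHom H (Path m)
proper⇒pathEmbedding {H = H} ((_ , H⊆C) , inj₁ (b , _ , b∉H)) =
  Rotation.path-embedding b H⊆C λ e _ v≡b → b∉H (subst (vert H) v≡b (proj₂ (edge-vert H e)))
proper⇒pathEmbedding {m} {H = H} ((_ , H⊆C) , inj₂ (x , y , xy∈C , xy∉H)) with cycleEdge⇒next xy∈C
... | inj₁ x→y = Rotation.path-embedding y H⊆C λ {u} e u→v v≡y →
  xy∉H (subst₂ (edge H) (next-injectiveˡ (subst (Next m u) v≡y u→v) x→y) v≡y e)
... | inj₂ y→x = Rotation.path-embedding x H⊆C λ {u} e u→v v≡x →
  xy∉H (edge-sym H (subst₂ (edge H) (next-injectiveˡ (subst (Next m u) v≡x u→v) y→x) v≡x e))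

-- Since Z has no two consecutive elements, every step of seq has length 1 or 2.
module Greedy {Z : ℕ → Set} (Z? : Decidable Z) (sparse : ∀ k → Z k → ¬ Z (suc k)) where

  skip : ℕ → ℕ
  skip k with Z? k
  ... | yes _ = suc k
  ... | no _  = k

  skip-∉ : ∀ k → ¬ Z (skip k)
  skip-∉ k with Z? k
  ... | yes Zk = sparse k Zk
  ... | no ¬Zk = ¬Zk

  skip-bounds : ∀ k → k ≤ skip k × skip k ≤ suc k
  skip-bounds k with Z? k
  ... | yes _ = n≤1+n k , ≤-refl
  ... | no _  = ≤-refl , n≤1+n k

  seq : ℕ → ℕ
  seq zero    = skip 0
  seq (suc i) = skip (suc (seq i))

  seq-∉ : ∀ i → ¬ Z (seq i)
  seq-∉ zero    = skip-∉ 0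
  seq-∉ (suc i) = skip-∉ (suc (seq i))

  seq-≤ : ∀ i → seq i ≤ suc (2 * i)
  seq-≤ zero    = proj₂ (skip-bounds 0)
  seq-≤ (suc i) = begin
    skip (suc (seq i))     ≤⟨ proj₂ (skip-bounds (suc (seq i))) ⟩
    2 + seq i              ≤⟨ +-monoʳ-≤ 2 (seq-≤ i) ⟩
    suc (2 + 2 * i)        ≡⟨ cong suc (*-suc 2 i) ⟨
    suc (2 * suc i)        ∎
    where open ≤-Reasoning

  seq-spread : ∀ p d → seq p + d ≤ seq (d + p) × seq (d + p) ≤ 2 * d + seq p
  seq-spread p zero = ≤-reflexive (+-identityʳ (seq p)) , ≤-refl
  seq-spread p (suc d) with seq-spread p d | skip-bounds (suc (seq (d + p)))
  ... | lo , hi | lo′ , hi′ =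
    ≤-trans (≤-reflexive (+-suc (seq p) d)) (≤-trans (s≤s lo) lo′) ,
    ≤-trans hi′ (≤-trans (s≤s (s≤s hi)) (≤-reflexive (cong (_+ seq p) (sym (*-suc 2 d)))))

  seq-<-spread : ∀ {p q} → p < q → seq p < seq q × seq q ∸ seq p ≤ 2 * (q ∸ p)
  seq-<-spread {p} {q} p<q = seq-p<seq-q , seq-q∸seq-p≤2d
    where
    d = q ∸ p
    d+p≡q : d + p ≡ q
    d+p≡q = m∸n+n≡m (<⇒≤ p<q)
    seq-p<seq-q : seq p < seq q
    seq-p<seq-q = begin-strict
      seq p          <⟨ m<m+n (seq p) (m<n⇒0<n∸m p<q) ⟩
      seq p + d      ≤⟨ proj₁ (seq-spread p d) ⟩
      seq (d + p)    ≡⟨ cong seq d+p≡q ⟩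
      seq q          ∎
      where open ≤-Reasoning
    seq-q∸seq-p≤2d : seq q ∸ seq p ≤ 2 * d
    seq-q∸seq-p≤2d = begin
      seq q ∸ seq p           ≡⟨ cong (λ x → seq x ∸ seq p) d+p≡q ⟨
      seq (d + p) ∸ seq p     ≤⟨ ∸-monoˡ-≤ (seq p) (proj₂ (seq-spread p d)) ⟩
      2 * d + seq p ∸ seq p   ≡⟨ m+n∸n≡m (2 * d) (seq p) ⟩
      2 * d                   ∎
      where open ≤-Reasoning

module PathHalving {n j : ℕ} {S S′ : ℕ → ℕ}
  (1≤S₀ : 1 ≤ S 0) (S′≤halfS : ∀ i → S′ i ≤ S (suc i) / 2)
  (ψ : Fin (2 * n) → Fin (suc j)) (ψ-packing : IsPackingColoring S (Path (2 * n)) (suc j) ψ) where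

  FirstColourAt : ℕ → Set
  FirstColourAt k = Σ (k < 2 * n) λ k<2n → ψ (fromℕ< k<2n) ≡ fzero

  firstColourAt? : Decidable FirstColourAt
  firstColourAt? k with k <? 2 * n
  ... | yes k<2n = map′ (k<2n ,_) proj₂ (ψ (fromℕ< k<2n) ≟ᶠ fzero)
  ... | no k≮2n  = no (k≮2n ∘ proj₁)

  firstColour-sparse : ∀ k → FirstColourAt k → ¬ FirstColourAt (suc k)
  firstColour-sparse k (k<2n , ψa≡0) (k+1<2n , ψb≡0) =
    ψ-packing a b tt tt a≢b (trans ψa≡0 (sym ψb≡0)) 1 (subst (λ c → 1 ≤ S (toℕ c)) (sym ψa≡0) 1≤S₀)
      (cons (inj₁ a+1≡b) nil)
    where
    a = fromℕ< k<2n
    b = fromℕ< k+1<2n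
    a+1≡b : suc (toℕ a) ≡ toℕ b
    a+1≡b = trans (cong suc (toℕ-fromℕ< k<2n)) (sym (toℕ-fromℕ< k+1<2n))
    a≢b : a ≢ b
    a≢b a≡b = 1+n≢n (trans a+1≡b (cong toℕ (sym a≡b)))

  open Greedy firstColourAt? firstColour-sparse

  seq<2n : (i : Fin n) → seq (toℕ i) < 2 * n
  seq<2n i = begin-strict
    seq (toℕ i)          ≤⟨ seq-≤ (toℕ i) ⟩
    suc (2 * toℕ i)      <⟨ ≤-refl ⟩
    2 + 2 * toℕ i        ≡⟨ *-suc 2 (toℕ i) ⟨
    2 * suc (toℕ i)      ≤⟨ *-monoʳ-≤ 2 (toℕ<n i) ⟩
    2 * n                ∎
    where open ≤-Reasoning

  pick : Fin n → Fin (2 * n)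
  pick i = fromℕ< (seq<2n i)

  toℕ-pick : ∀ i → toℕ (pick i) ≡ seq (toℕ i)
  toℕ-pick i = toℕ-fromℕ< (seq<2n i)

  pick-nonzero : ∀ i → fzero ≢ ψ (pick i)
  pick-nonzero i 0≡ψ = seq-∉ (toℕ i) (seq<2n i , sym 0≡ψ)

  φ : Fin n → Fin j
  φ i = punchOut (pick-nonzero i)

  ψ-pick : ∀ i → ψ (pick i) ≡ fsuc (φ i)
  ψ-pick i = sym (punchIn-punchOut (pick-nonzero i))

  φ-far : ∀ u v → toℕ u < toℕ v → φ u ≡ φ v → DistGt (Path n) u v (S′ (toℕ (φ u)))
  φ-far u v u<v same ℓ ℓ≤S′ W =
    ψ-packing (pick u) (pick v) tt tt pick-u≢pick-v ψ-same D D≤S (path-walk D D+pick-u≡pick-v)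
    where
    spread = seq-<-spread u<v
    D = seq (toℕ v) ∸ seq (toℕ u)
    D+pick-u≡pick-v : D + toℕ (pick u) ≡ toℕ (pick v)
    D+pick-u≡pick-v =
      trans (cong (D +_) (toℕ-pick u)) (trans (m∸n+n≡m (<⇒≤ (proj₁ spread))) (sym (toℕ-pick v)))
    pick-u≢pick-v : pick u ≢ pick v
    pick-u≢pick-v eq = <⇒≢ (proj₁ spread) (trans (sym (toℕ-pick u)) (trans (cong toℕ eq) (toℕ-pick v)))
    ψ-same : ψ (pick u) ≡ ψ (pick v)
    ψ-same = trans (ψ-pick u) (trans (cong fsuc same) (sym (ψ-pick v)))
    D≤S : D ≤ S (toℕ (ψ (pick u)))
    D≤S = begin
      D                            ≤⟨ proj₂ spread ⟩
      2 * (toℕ v ∸ toℕ u)          ≤⟨ *-monoʳ-≤ 2 (∸-monoˡ-≤ (toℕ u) (path-walk-≤ W)) ⟩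
      2 * (toℕ u + ℓ ∸ toℕ u)      ≡⟨ cong (2 *_) (m+n∸m≡n (toℕ u) ℓ) ⟩
      2 * ℓ                        ≤⟨ n≤o/m⇒m*n≤o 2 (≤-trans ℓ≤S′ (S′≤halfS _)) ⟩
      S (suc (toℕ (φ u)))          ≡⟨ cong (S ∘ toℕ) (ψ-pick u) ⟨
      S (toℕ (ψ (pick u)))         ∎
      where open ≤-Reasoning

  φ-packing : IsPackingColoring S′ (Path n) j φ
  φ-packing = packing-fromOrdered {S = S′} φ φ-far

pathColoring-halving : ∀ {n j} {S S′ : ℕ → ℕ} → 1 ≤ S 0 → (∀ i → S′ i ≤ S (suc i) / 2) →
  HasPackingColoring S (Path (2 * n)) (suc j) → HasPackingColoring S′ (Path n) j
pathColoring-halving {n} {S = S} 1≤S₀ S′≤halfS (ψ , ψ-packing) = φ , φ-packing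
  where open PathHalving {n} {S = S} 1≤S₀ S′≤halfS ψ ψ-packing

χ-properSubcycle<χ-path : ∀ {n kH kP} {S S′ : ℕ → ℕ} {H : Graph (suc n)} →
  1 ≤ S 0 → (∀ i → S′ i ≤ S (suc i) / 2) → ProperSubgraph H (Cycle (suc n)) →
  IsChiS S′ H kH → HasPackingColoring S (Path (2 * suc n)) kP → kH < kP
χ-properSubcycle<χ-path {kP = zero} _ _ _ _ (ψ , _) with ψ fzero
... | ()
χ-properSubcycle<χ-path {kP = suc j} {S} {S′} 1≤S₀ S′≤halfS H⊂C (_ , least) coloring =
  s≤s (least j (coloring-pullback {S = S′} (proper⇒pathEmbedding H⊂C)
                                  (pathColoring-halving {S = S} 1≤S₀ S′≤halfS coloring)))

lemma2p3 : (S S′ : ℕ → ℕ) → IsPackingSeq S → IsPackingSeq S′ →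
    S 0 ≡ 1 → (∀ i → S′ i ≡ S (suc i) / 2) →
    (n : ℕ) → 3 ≤ n →
    (∀ k k′ → IsChiS S (Cycle (2 * n)) k → IsChiS S′ (Cycle n) k′ → k ≤ suc k′)
    × (IsCritical S (Cycle (2 * n)) → IsCritical S′ (Cycle n))
lemma2p3 S S′ _ _ S₀≡1 S′≡halfS n@(suc _) 3≤n = χ-doubling , criticality
  where
  χ-doubling : ∀ k k′ → IsChiS S (Cycle (2 * n)) k → IsChiS S′ (Cycle n) k′ → k ≤ suc k′
  χ-doubling _ k′ (_ , least) (coloring , _) = least (suc k′)
    (cycleColoring-doubling {S = S} {S′} (≤-reflexive S₀≡1) (λ i → ≤-reflexive (sym (S′≡halfS i))) coloring)

  criticality : IsCritical S (Cycle (2 * n)) → IsCritical S′ (Cycle n)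
  criticality critical H H⊂C kH kG χH χG = decidable-stable (kH <? kG) λ kH≮kG →
    ¬¬-IsChiS S (Cycle (2 * n)) λ { (kC , χC) →
    ¬¬-IsChiS S (Path (2 * n)) λ { (kP , χP) →
    kH≮kG (<-≤-trans (kH<kP (proj₁ χP))
                     (s≤s⁻¹ (≤-trans (critical (Path (2 * n)) (path-proper 3≤2n) kP kC χP χC)
                                     (χ-doubling kC kG χC χG)))) } }
    where
    3≤2n : 3 ≤ 2 * n
    3≤2n = ≤-trans 3≤n (m≤m+n n (n + 0))
    kH<kP : ∀ {kP} → HasPackingColoring S (Path (2 * n)) kP → kH < kP
    kH<kP = χ-properSubcycle<χ-path {S = S} {S′} (≤-reflexive (sym S₀≡1)) (λ i → ≤-reflexive (S′≡halfS i)) H⊂C χH
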